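{- Let $s\ge 1$ be an integer. For all integers $k\ge 1$ and $n\ge sk$, \[ L^{(s)}(n,k)=\binom{n-1}{s-1}\,s!\,L^{(s)}(n-s,k-1)+(n+k-1)\,L^{(s)}(n-1,k). \]
   Context: For an integer $s\ge1$ and integers $n,k\ge 0$, the $s$-associated Lah number $L^{(s)}(n,k)$ is the number of partitions of $\{1,\dots,n\}$ into exactly $k$ ordered lists (i.e. $k$ nonempty blocks, each endowed with a linear order, the collection of blocks being unordered) such that each list contains at least $s$ elements. In particular $L^{(s)}(n,0)=\delta_{n,0}$ and $L^{(s)}(n,k)=0$ when $n<sk$. -}

module Defs where

open import Data.Nat using (ℕ; zero; suc; _≤_; _≤?_)
open import Data.Nat.Properties using () renaming (_≟_ to _≟ℕ_)
open import Data.Fin using (Fin) renaming (_<_ to _<ᶠ_; _<?_ to _<ᶠ?_; _≟_ to _≟ᶠ_)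
open import Data.List using (List; []; _∷_; [_]; map; concatMap; concat; length; filter; allFin)
open import Data.List.Relation.Unary.All using (All; all?)
open import Data.List.Relation.Unary.AllPairs using (AllPairs; allPairs?)
open import Data.List.Relation.Unary.Unique.Propositional using (Unique)
open import Data.Product using (_×_)
open import Relation.Binary.PropositionalEquality using (_≡_)
open import Relation.Nullary using (Dec; ¬?)
open import Relation.Nullary.Decidable using (_×-dec_)

private
  variable
    A : Set

words : List A → ℕ → List (List A)
words xs zero    = [ [] ]
words xs (suc m) = concatMap (λ x → map (x ∷_) (words xs m)) xs

prepend : A → List (List A) → List (List (List A))
prepend x []         = [ [ x ] ∷ [] ]
prepend x (b ∷ bs)   = ([ x ] ∷ b ∷ bs) ∷ ((x ∷ b) ∷ bs) ∷ []

cuts : List A → List (List (List A))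
cuts []       = [ [] ]
cuts (x ∷ xs) = concatMap (prepend x) (cuts xs)

firsts : List (List A) → List A
firsts []             = []
firsts ([] ∷ bss)     = firsts bss
firsts ((x ∷ _) ∷ bss) = x ∷ firsts bss

-- Each inner list is a block with its linear order; the
-- collection of blocks is unordered, represented canonically by listing the
-- blocks in increasing order of their first elements.
IsOLP : ℕ → (n : ℕ) → ℕ → List (List (Fin n)) → Set
IsOLP s n k xss =
  length xss ≡ k
  × All (λ b → 1 ≤ length b × s ≤ length b) xss
  × Unique (concat xss)
  × length (concat xss) ≡ n
  × AllPairs _<ᶠ_ (firsts xss)

isOLP? : (s n k : ℕ) → (xss : List (List (Fin n))) → Dec (IsOLP s n k xss)
isOLP? s n k xss =
  (length xss ≟ℕ k)
  ×-dec all? (λ b → (1 ≤? length b) ×-dec (s ≤? length b)) xss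
  ×-dec allPairs? (λ x y → ¬? (x ≟ᶠ y)) (concat xss)
  ×-dec (length (concat xss) ≟ℕ n)
  ×-dec allPairs? _<ᶠ?_ (firsts xss)

candidates : (n : ℕ) → List (List (List (Fin n)))
candidates n = concatMap cuts (words (allFin n) n)

L : (s n k : ℕ) → ℕ
L s n k = length (filter (isOLP? s n k) (candidates n))

module Submission where

-- Call an arrangement of a duplicate-free list G into k
-- blocks a sequence of k blocks, each with at least s elements, whose
-- concatenation is a rearrangement of G; the Lah partitions counted by L are
-- exactly the arrangements of {0,…,n-1} listed by increasing first elements.
--
-- Arrangements of m ∷ G split by the size of the block containing m: if it
-- has exactly s elements, it consists of m and s-1 companions chosen from G
-- in some order, placed among the k blocks of an arrangement of the rest
-- (C(n-1,s-1) · s! · k ways); otherwise removing m leaves an arrangement of G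
-- into k blocks, into which m can be reinserted in (n-1) + k positions.

open import Defs
open import Data.Nat using (ℕ; zero; suc; _+_; _*_; _∸_; _≤_; _<_; z≤n; s≤s; _!)
open import Data.Nat.Combinatorics using (_C_; nCk+nC[k+1]≡[n+1]C[k+1])
open import Data.Nat.Properties
open import Data.Fin using (Fin; toℕ) renaming (_<_ to _<ᶠ_)
import Data.Fin.Properties as Fin
open import Data.List using (List; []; _∷_; [_]; _++_; map; concat; concatMap; length; filter; allFin)
open import Data.List.Properties using (∷-injectiveˡ; ∷-injectiveʳ; length-++; length-map; length-tabulate; concat-++)
open import Data.List.Relation.Unary.All using (All; []; _∷_)
import Data.List.Relation.Unary.All as All
import Data.List.Relation.Unary.All.Properties as All
open import Data.List.Relation.Unary.Any using (here; there)
open import Data.List.Relation.Unary.AllPairs using (AllPairs; []; _∷_)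
open import Data.List.Relation.Unary.Unique.Propositional using (Unique)
import Data.List.Relation.Unary.Unique.Propositional.Properties as Unique
open import Data.List.Membership.Propositional using (_∈_; _∉_; lose; find)
open import Data.List.Membership.Propositional.Properties
  using (∈-++⁺ˡ; ∈-++⁺ʳ; ∈-++⁻; ∈-∃++; ∈-map⁺; ∈-map⁻; ∈-concatMap⁺; ∈-concatMap⁻;
         ∈-concat⁺′; ∈-concat⁻′; ∈-filter⁺; ∈-filter⁻; ∈-allFin)
open import Data.List.Relation.Binary.Permutation.Propositional
  using (_↭_; ↭-refl; ↭-sym; ↭-trans; ↭-prep; ↭-reflexive)
import Data.List.Relation.Binary.Permutation.Propositional as Perm
open import Data.List.Relation.Binary.Permutation.Propositional.Properties
  using (∈-resp-↭; All-resp-↭; shift; shifts; drop-∷; ++⁺ˡ; ++⁺ʳ; ++⁺; ↭-length; ↭-empty-inv)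
open import Data.List.Relation.Ternary.Interleaving using ([])
open import Data.List.Relation.Ternary.Interleaving.Propositional using (Interleaving; consˡ; consʳ; toPermutation)
open import Data.List.Relation.Ternary.Interleaving.Properties using (interleave-length)
open import Data.List.Relation.Binary.BagAndSetEquality using (∼bag⇒↭; ↭⇒∼bag; concat-cong)
open import Data.List.Membership.Propositional.Properties.WithK using (unique∧set⇒bag)
import Data.List.Relation.Binary.Permutation.Setoid.Properties as PermSetoid
open import Data.List.Relation.Unary.Sorted.TotalOrder.Properties using (Sorted⇒AllPairs)
import Relation.Binary.Construct.On as On
open import Relation.Binary.Bundles using (DecTotalOrder)
open import Function.Bundles using (mk⇔)
open import Data.Nat.Tactic.RingSolver using (solve-∀)
open import Data.Product using (∃; ∃₂; _×_; _,_; proj₁; proj₂; map₁; map₂)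
open import Data.Sum using (inj₁; inj₂)
open import Data.Empty using (⊥; ⊥-elim)
open import Relation.Nullary using (¬_; yes; no)
open import Relation.Binary.PropositionalEquality using (_≡_; _≢_; refl; sym; trans; cong; cong₂; subst; setoid; module ≡-Reasoning)

private
  variable
    A B : Set

∈-concatMap-intro : (f : A → List B) {xs : List A} {x : A} {z : B} → x ∈ xs → z ∈ f x → z ∈ concatMap f xs
∈-concatMap-intro f x∈ z∈ = ∈-concatMap⁺ f (lose x∈ z∈)

∈-concatMap-elim : (f : A → List B) (xs : List A) {z : B} → z ∈ concatMap f xs → ∃ λ x → x ∈ xs × z ∈ f x
∈-concatMap-elim f xs z∈ = find (∈-concatMap⁻ f z∈)

length-concatMap : (f : A → List B) (xs : List A) (c : ℕ) → (∀ x → x ∈ xs → length (f x) ≡ c) →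
                   length (concatMap f xs) ≡ length xs * c
length-concatMap f [] c h = refl
length-concatMap f (x ∷ xs) c h =
  trans (length-++ (f x)) (cong₂ _+_ (h x (here refl)) (length-concatMap f xs c (λ y p → h y (there p))))

Unique-concatMap : (f : A → List B) (xs : List A) → Unique xs → (∀ x → x ∈ xs → Unique (f x)) →
                   (∀ x y {z} → x ∈ xs → y ∈ xs → z ∈ f x → z ∈ f y → x ≡ y) → Unique (concatMap f xs)
Unique-concatMap f [] _ _ _ = []
Unique-concatMap f (x ∷ xs) (x∉xs ∷ uxs) uf disj =
  Unique.++⁺ (uf x (here refl))
             (Unique-concatMap f xs uxs (λ y p → uf y (there p)) (λ y y' p q → disj y y' (there p) (there q)))
             λ (z∈fx , z∈rest) → let (y , y∈ , z∈fy) = ∈-concatMap-elim f xs z∈rest in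
                                 All.lookup x∉xs y∈ (disj x y (here refl) (there y∈) z∈fx z∈fy)

length-middle : (u : List A) (x : A) (v : List A) → length (u ++ x ∷ v) ≡ suc (length (u ++ v))
length-middle [] x v = refl
length-middle (a ∷ u) x v = cong suc (length-middle u x v)

∈-delete-middle : (u : List A) {x z : A} {v : List A} → z ∈ u ++ x ∷ v → z ≢ x → z ∈ u ++ v
∈-delete-middle [] (here e) z≢x = ⊥-elim (z≢x e)
∈-delete-middle [] (there p) z≢x = p
∈-delete-middle (a ∷ u) (here e) z≢x = here e
∈-delete-middle (a ∷ u) (there p) z≢x = there (∈-delete-middle u p z≢x)

Unique-⊆-length : {xs ys : List A} → Unique xs → (∀ {z} → z ∈ xs → z ∈ ys) → length xs ≤ length ys
Unique-⊆-length {xs = []} _ _ = z≤n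
Unique-⊆-length {xs = x ∷ xs} {ys} (x∉xs ∷ uxs) xs⊆ys with ∈-∃++ (xs⊆ys (here refl))
... | u , v , refl = subst (suc (length xs) ≤_) (sym (length-middle u x v))
        (s≤s (Unique-⊆-length uxs λ z∈ → ∈-delete-middle u (xs⊆ys (there z∈)) (λ e → All.lookup x∉xs z∈ (sym e))))

Unique-⇔-↭ : {xs ys : List A} → Unique xs → Unique ys →
             (∀ {z} → z ∈ xs → z ∈ ys) → (∀ {z} → z ∈ ys → z ∈ xs) → xs ↭ ys
Unique-⇔-↭ uxs uys f g = ∼bag⇒↭ (unique∧set⇒bag uxs uys (mk⇔ f g))

Unique-resp-↭ : {xs ys : List A} → xs ↭ ys → Unique xs → Unique ys
Unique-resp-↭ {A = A} p = PermSetoid.Unique-resp-↭ (setoid A) (Perm.↭⇒↭ₛ p)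

concat-↭ : {xss yss : List (List A)} → xss ↭ yss → concat xss ↭ concat yss
concat-↭ p = ∼bag⇒↭ (concat-cong (↭⇒∼bag p))


first-split-unique : (P : A → Set) (u u' : List A) {x x' : A} {v v' : List A} →
                     All (λ a → ¬ P a) u → All (λ a → ¬ P a) u' → P x → P x' →
                     u ++ x ∷ v ≡ u' ++ x' ∷ v' → u ≡ u' × x ≡ x' × v ≡ v'
first-split-unique P [] [] _ _ _ _ refl = refl , refl , refl
first-split-unique P [] (a ∷ u') _ (¬Pa ∷ _) Px _ e = ⊥-elim (¬Pa (subst P (∷-injectiveˡ e) Px))
first-split-unique P (a ∷ u) [] (¬Pa ∷ _) _ _ Px' e = ⊥-elim (¬Pa (subst P (sym (∷-injectiveˡ e)) Px'))
first-split-unique P (a ∷ u) (b ∷ u') (_ ∷ ¬Pu) (_ ∷ ¬Pu') Px Px' e with ∷-injectiveˡ e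
... | refl with first-split-unique P u u' ¬Pu ¬Pu' Px Px' (∷-injectiveʳ e)
... | refl , refl , refl = refl , refl , refl

∉⇒All≢ : {x : A} (u : List A) → x ∉ u → All (x ≢_) u
∉⇒All≢ u x∉u = All.tabulate λ a∈u x≡a → x∉u (subst (_∈ u) (sym x≡a) a∈u)

All≢⇒∉ : {x : A} {xs : List A} → All (x ≢_) xs → x ∉ xs
All≢⇒∉ x≢xs x∈xs = All.lookup x≢xs x∈xs refl

insertions : A → List A → List (List A)
insertions x [] = [ [ x ] ]
insertions x (y ∷ ys) = (x ∷ y ∷ ys) ∷ map (y ∷_) (insertions x ys)

∈-insertions⁺ : (x : A) (u v : List A) → u ++ x ∷ v ∈ insertions x (u ++ v)
∈-insertions⁺ x [] [] = here refl
∈-insertions⁺ x [] (y ∷ v) = here refl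
∈-insertions⁺ x (a ∷ u) v = there (∈-map⁺ (a ∷_) (∈-insertions⁺ x u v))

∈-insertions⁻ : (x : A) (ys : List A) {z : List A} → z ∈ insertions x ys →
                ∃₂ λ u v → ys ≡ u ++ v × z ≡ u ++ x ∷ v
∈-insertions⁻ x [] (here refl) = [] , [] , refl , refl
∈-insertions⁻ x (y ∷ ys) (here refl) = [] , y ∷ ys , refl , refl
∈-insertions⁻ x (y ∷ ys) (there p) with ∈-map⁻ (y ∷_) p
... | w , w∈ , refl with ∈-insertions⁻ x ys w∈
... | u , v , refl , refl = y ∷ u , v , refl , refl

length-insertions : (x : A) (ys : List A) → length (insertions x ys) ≡ suc (length ys)
length-insertions x [] = refl
length-insertions x (y ∷ ys) = cong suc (trans (length-map (y ∷_) (insertions x ys)) (length-insertions x ys))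

Unique-insertions : (x : A) (ys : List A) → x ∉ ys → Unique (insertions x ys)
Unique-insertions x [] _ = [] ∷ []
Unique-insertions x (y ∷ ys) x∉ =
  All.tabulate (λ w∈ e → let (_ , _ , e') = ∈-map⁻ (y ∷_) w∈ in x∉ (here (∷-injectiveˡ (trans e e'))))
  ∷ Unique.map⁺ ∷-injectiveʳ (Unique-insertions x ys (λ p → x∉ (there p)))

permutations : List A → List (List A)
permutations [] = [ [] ]
permutations (x ∷ xs) = concatMap (insertions x) (permutations xs)

permutations-sound : (xs : List A) {z : List A} → z ∈ permutations xs → z ↭ xs
permutations-sound [] (here refl) = ↭-refl
permutations-sound (x ∷ xs) z∈ with ∈-concatMap-elim (insertions x) (permutations xs) z∈
... | w , w∈ , z∈' with ∈-insertions⁻ x w z∈'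
... | u , v , refl , refl = ↭-trans (shift x u v) (↭-prep x (permutations-sound xs w∈))

permutations-complete : (xs : List A) {z : List A} → z ↭ xs → z ∈ permutations xs
permutations-complete [] p rewrite ↭-empty-inv p = here refl
permutations-complete (x ∷ xs) p with ∈-∃++ (∈-resp-↭ (↭-sym p) (here refl))
... | u , v , refl = ∈-concatMap-intro (insertions x)
        (permutations-complete xs (drop-∷ (↭-trans (↭-sym (shift x u v)) p))) (∈-insertions⁺ x u v)

length-permutations : (xs : List A) → length (permutations xs) ≡ length xs !
length-permutations [] = refl
length-permutations (x ∷ xs) = begin
  length (concatMap (insertions x) (permutations xs))
    ≡⟨ length-concatMap (insertions x) (permutations xs) (suc (length xs)) length-insert ⟩
  length (permutations xs) * suc (length xs)   ≡⟨ cong (_* suc (length xs)) (length-permutations xs) ⟩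
  length xs ! * suc (length xs)               ≡⟨ *-comm (length xs !) (suc (length xs)) ⟩
  suc (length xs) !                           ∎
  where
  open ≡-Reasoning
  length-insert : ∀ w → w ∈ permutations xs → length (insertions x w) ≡ suc (length xs)
  length-insert w w∈ = trans (length-insertions x w) (cong suc (↭-length (permutations-sound xs w∈)))

-- Permutations of a duplicate-free list are pairwise distinct: two insertions
-- of the head are equal only if they come from the same permutation of the
-- tail, since the head marks a unique position.
Unique-permutations : (xs : List A) → Unique xs → Unique (permutations xs)
Unique-permutations [] _ = [] ∷ []
Unique-permutations (x ∷ xs) (x∉xs ∷ uxs) =
  Unique-concatMap (insertions x) (permutations xs) (Unique-permutations xs uxs)
    (λ w w∈ → Unique-insertions x w (x∉ w∈)) disjoint
  where
  x∉ : ∀ {w} → w ∈ permutations xs → x ∉ w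
  x∉ w∈ x∈w = All≢⇒∉ x∉xs (∈-resp-↭ (permutations-sound xs w∈) x∈w)
  x∉prefix : ∀ {w} u {v} → w ∈ permutations xs → w ≡ u ++ v → All (x ≢_) u
  x∉prefix u w∈ refl = ∉⇒All≢ u (λ x∈u → x∉ w∈ (∈-++⁺ˡ x∈u))
  disjoint : ∀ w w' {z} → w ∈ permutations xs → w' ∈ permutations xs →
             z ∈ insertions x w → z ∈ insertions x w' → w ≡ w'
  disjoint w w' w∈ w'∈ z∈ z∈' with ∈-insertions⁻ x w z∈ | ∈-insertions⁻ x w' z∈'
  ... | u , v , w≡ , z≡ | u' , v' , w'≡ , z≡' with
        first-split-unique (x ≡_) u u' (x∉prefix u w∈ w≡) (x∉prefix u' w'∈ w'≡) refl refl (trans (sym z≡) z≡')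
  ... | refl , _ , refl = trans w≡ (sym w'≡)

∈-interleavingˡ : {c r X : List A} {z : A} → Interleaving c r X → z ∈ c → z ∈ X
∈-interleavingˡ {c = c} i z∈ = ∈-resp-↭ (↭-sym (toPermutation i)) (∈-++⁺ˡ z∈)

∈-interleavingʳ : {c r X : List A} {z : A} → Interleaving c r X → z ∈ r → z ∈ X
∈-interleavingʳ {c = c} i z∈ = ∈-resp-↭ (↭-sym (toPermutation i)) (∈-++⁺ʳ c z∈)

Unique-interleavingˡ : {c r X : List A} → Unique X → Interleaving c r X → Unique c
Unique-interleavingˡ [] [] = []
Unique-interleavingˡ (x∉ ∷ uX) (consˡ i) = All.tabulate (λ y∈ → All.lookup x∉ (∈-interleavingˡ i y∈)) ∷ Unique-interleavingˡ uX i
Unique-interleavingˡ (_ ∷ uX) (consʳ i) = Unique-interleavingˡ uX i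

Unique-interleavingʳ : {c r X : List A} → Unique X → Interleaving c r X → Unique r
Unique-interleavingʳ [] [] = []
Unique-interleavingʳ (x∉ ∷ uX) (consʳ i) = All.tabulate (λ y∈ → All.lookup x∉ (∈-interleavingʳ i y∈)) ∷ Unique-interleavingʳ uX i
Unique-interleavingʳ (_ ∷ uX) (consˡ i) = Unique-interleavingʳ uX i

length-interleavingʳ : {c r X : List A} → Interleaving c r X → length r ≡ length X ∸ length c
length-interleavingʳ {c = c} {r} i = sym (trans (cong (_∸ length c) (interleave-length i)) (m+n∸m≡n (length c) (length r)))

↭⇒interleaving : (X : List A) {c r : List A} → c ++ r ↭ X → ∃₂ λ c' r' → Interleaving c' r' X × c' ↭ c × r' ↭ r
↭⇒interleaving [] {c} {r} p with c | r | ↭-empty-inv p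
... | [] | [] | refl = [] , [] , [] , ↭-refl , ↭-refl
↭⇒interleaving (x ∷ X) {c} {r} p with ∈-++⁻ c (∈-resp-↭ (↭-sym p) (here refl))
... | inj₁ x∈c with ∈-∃++ x∈c
...   | u , v , refl with ↭⇒interleaving X {u ++ v} {r} (drop-∷ (↭-trans (↭-sym moveˡ) p))
  where
  moveˡ : (u ++ x ∷ v) ++ r ↭ x ∷ (u ++ v) ++ r
  moveˡ = ++⁺ʳ r (shift x u v)
...   | c' , r' , i , pc , pr = x ∷ c' , r' , consˡ i , ↭-trans (↭-prep x pc) (↭-sym (shift x u v)) , pr
↭⇒interleaving (x ∷ X) {c} {r} p | inj₂ x∈r with ∈-∃++ x∈r
... | u , v , refl with ↭⇒interleaving X {c} {u ++ v} (drop-∷ (↭-trans (↭-sym moveʳ) p))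
  where
  moveʳ : c ++ u ++ x ∷ v ↭ x ∷ c ++ u ++ v
  moveʳ = ↭-trans (++⁺ˡ c (shift x u v)) (shift x c (u ++ v))
... | c' , r' , i , pc , pr = c' , x ∷ r' , consʳ i , pc , ↭-trans (↭-prep x pr) (↭-sym (shift x u v))

interleaving-determined : {X c r c' r' : List A} → Unique X → Interleaving c r X → Interleaving c' r' X →
                          c ↭ c' → c ≡ c' × r ≡ r'
interleaving-determined [] [] [] _ = refl , refl
interleaving-determined (_ ∷ uX) (consˡ i) (consˡ i') p with interleaving-determined uX i i' (drop-∷ p)
... | refl , refl = refl , refl
interleaving-determined (_ ∷ uX) (consʳ i) (consʳ i') p with interleaving-determined uX i i' p
... | refl , refl = refl , refl
interleaving-determined (x∉ ∷ _) (consˡ i) (consʳ i') p = ⊥-elim (All≢⇒∉ x∉ (∈-interleavingˡ i' (∈-resp-↭ p (here refl))))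
interleaving-determined (x∉ ∷ _) (consʳ i) (consˡ i') p = ⊥-elim (All≢⇒∉ x∉ (∈-interleavingˡ i (∈-resp-↭ (↭-sym p) (here refl))))

splits : ℕ → List A → List (List A × List A)
splits zero X = [ ([] , X) ]
splits (suc t) [] = []
splits (suc t) (x ∷ X) = map (map₁ (x ∷_)) (splits t X) ++ map (map₂ (x ∷_)) (splits (suc t) X)

splits-sound : (t : ℕ) (X : List A) {p : List A × List A} → p ∈ splits t X →
               Interleaving (proj₁ p) (proj₂ p) X × length (proj₁ p) ≡ t
splits-sound zero X (here refl) = all-right X , refl
  where
  all-right : (X : List A) → Interleaving [] X X
  all-right [] = []
  all-right (x ∷ X) = consʳ (all-right X)
splits-sound (suc t) (x ∷ X) p∈ with ∈-++⁻ (map (map₁ (x ∷_)) (splits t X)) p∈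
... | inj₁ p∈ˡ with ∈-map⁻ (map₁ (x ∷_)) p∈ˡ
...   | _ , q∈ , refl = let (i , len) = splits-sound t X q∈ in consˡ i , cong suc len
splits-sound (suc t) (x ∷ X) p∈ | inj₂ p∈ʳ with ∈-map⁻ (map₂ (x ∷_)) p∈ʳ
...   | _ , q∈ , refl = let (i , len) = splits-sound (suc t) X q∈ in consʳ i , len

splits-complete : {c r X : List A} → Interleaving c r X → (c , r) ∈ splits (length c) X
splits-complete [] = here refl
splits-complete {c = []} (consʳ i) with splits-complete i
... | here refl = here refl
splits-complete {c = _ ∷ c} {X = x ∷ X} (consʳ i) =
  ∈-++⁺ʳ (map (map₁ (x ∷_)) (splits (length c) X)) (∈-map⁺ (map₂ (x ∷_)) (splits-complete i))
splits-complete {X = x ∷ _} (consˡ i) = ∈-++⁺ˡ (∈-map⁺ (map₁ (x ∷_)) (splits-complete i))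

length-splits : (t : ℕ) (X : List A) → length (splits t X) ≡ length X C t
length-splits zero X = refl
length-splits (suc t) [] = refl
length-splits (suc t) (x ∷ X) = begin
  length (map (map₁ (x ∷_)) (splits t X) ++ map (map₂ (x ∷_)) (splits (suc t) X))
    ≡⟨ length-++ (map (map₁ (x ∷_)) (splits t X)) ⟩
  length (map (map₁ (x ∷_)) (splits t X)) + length (map (map₂ (x ∷_)) (splits (suc t) X))
    ≡⟨ cong₂ _+_ (length-map (map₁ (x ∷_)) (splits t X)) (length-map (map₂ (x ∷_)) (splits (suc t) X)) ⟩
  length (splits t X) + length (splits (suc t) X)
    ≡⟨ cong₂ _+_ (length-splits t X) (length-splits (suc t) X) ⟩
  length X C t + length X C suc t
    ≡⟨ nCk+nC[k+1]≡[n+1]C[k+1] (length X) t ⟩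
  suc (length X) C suc t ∎
  where open ≡-Reasoning

-- The head of a duplicate-free X lies in the chosen part of the first
-- family of splits and not in that of the second, so all splits differ.
Unique-splits : (t : ℕ) (X : List A) → Unique X → Unique (splits t X)
Unique-splits zero X _ = [] ∷ []
Unique-splits (suc t) [] _ = []
Unique-splits (suc t) (x ∷ X) (x∉ ∷ uX) =
  Unique.++⁺ (Unique.map⁺ (λ e → pair-≡ (∷-injectiveʳ (cong proj₁ e)) (cong proj₂ e)) (Unique-splits t X uX))
             (Unique.map⁺ (λ e → pair-≡ (cong proj₁ e) (∷-injectiveʳ (cong proj₂ e))) (Unique-splits (suc t) X uX))
             λ (p∈ˡ , p∈ʳ) →
               let (_ , _ , eˡ) = ∈-map⁻ (map₁ (x ∷_)) p∈ˡ
                   (q , q∈ , eʳ) = ∈-map⁻ (map₂ (x ∷_)) p∈ʳ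
                   x∈c = subst (x ∈_) (trans (sym (cong proj₁ eˡ)) (cong proj₁ eʳ)) (here refl)
               in All≢⇒∉ x∉ (∈-interleavingˡ (proj₁ (splits-sound (suc t) X q∈)) x∈c)
  where
  pair-≡ : {p q : List A × List A} → proj₁ p ≡ proj₁ q → proj₂ p ≡ proj₂ q → p ≡ q
  pair-≡ {p = _ , _} {q = _ , _} refl refl = refl

concat-middle : (u : List (List A)) (B : List A) (v : List (List A)) → concat (u ++ B ∷ v) ↭ B ++ concat (u ++ v)
concat-middle u B v = ↭-trans (↭-reflexive (sym (concat-++ u (B ∷ v))))
                       (↭-trans (shifts (concat u) B) (↭-reflexive (cong (B ++_) (concat-++ u v))))

All-middle⁺ : {P : A → Set} (u : List A) {x : A} {v : List A} → All P (u ++ v) → P x → All P (u ++ x ∷ v)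
All-middle⁺ u Puv Px = let (Pu , Pv) = All.++⁻ u Puv in All.++⁺ Pu (Px ∷ Pv)

All-middle⁻ : {P : A → Set} (u : List A) {x : A} {v : List A} → All P (u ++ x ∷ v) → All P (u ++ v) × P x
All-middle⁻ u Puxv with All.++⁻ u Puxv
... | Pu , Px ∷ Pv = All.++⁺ Pu Pv , Px

∉-concat⇒All : {m : A} (bs : List (List A)) → m ∉ concat bs → All (λ b → ¬ m ∈ b) bs
∉-concat⇒All bs m∉ = All.tabulate λ b∈ m∈b → m∉ (∈-concat⁺′ m∈b b∈)

marked-block-unique : {m : A} (pre pre' : List (List A)) {B B' : List A} {post post' : List (List A)} →
                      m ∉ concat pre → m ∉ concat pre' → m ∈ B → m ∈ B' →
                      pre ++ B ∷ post ≡ pre' ++ B' ∷ post' → pre ≡ pre' × B ≡ B' × post ≡ post'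
marked-block-unique {m = m} pre pre' m∉ m∉' =
  first-split-unique (m ∈_) pre pre' (∉-concat⇒All pre m∉) (∉-concat⇒All pre' m∉')

module Arrangements (s′ : ℕ) where

  count : ℕ → ℕ → ℕ
  count zero zero = 1
  count zero (suc n) = 0
  count (suc k) zero = 0
  count (suc k) (suc n) = (n C s′) * suc s′ ! * count k (n ∸ s′) * suc k + count (suc k) n * (n + suc k)

  module _ {A : Set} where

    Enumerator : Set
    Enumerator = List A → List (List (List A))

    record IsArrangement (k : ℕ) (G : List A) (z : List (List A)) : Set where
      constructor arrangement
      field
        blockCount : length z ≡ k
        large : All (λ b → suc s′ ≤ length b) z
        covers : concat z ↭ G

    placeBlock : List (List (List A)) → List A → List (List (List A))
    placeBlock rs B = concatMap (insertions B) rs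

    exactBlockFrom : Enumerator → A → List A × List A → List (List (List A))
    exactBlockFrom arrange m (c , rest) = concatMap (placeBlock (arrange rest)) (permutations (m ∷ c))

    withExactBlock : Enumerator → A → List A → List (List (List A))
    withExactBlock arrange m G = concatMap (exactBlockFrom arrange m) (splits s′ G)

    insertIntoBlocks : A → List (List A) → List (List (List A))
    insertIntoBlocks m [] = []
    insertIntoBlocks m (b ∷ bs) = map (_∷ bs) (insertions m b) ++ map (b ∷_) (insertIntoBlocks m bs)

    arrangements : ℕ → Enumerator
    arrangements zero [] = [ [] ]
    arrangements zero (_ ∷ _) = []
    arrangements (suc k) [] = []
    arrangements (suc k) (m ∷ G) =
      withExactBlock (arrangements k) m G ++ concatMap (insertIntoBlocks m) (arrangements (suc k) G)

    record ExactBlockView (arrange : Enumerator) (m : A) (c rest : List A)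
                          (z : List (List A)) : Set where
      field
        block : List A
        pre post : List (List A)
        block∈ : block ∈ permutations (m ∷ c)
        remainder∈ : pre ++ post ∈ arrange rest
        z≡ : z ≡ pre ++ block ∷ post

    exactBlock-view : (arrange : Enumerator) (m : A) (c rest : List A) {z : List (List A)} →
                      z ∈ exactBlockFrom arrange m (c , rest) → ExactBlockView arrange m c rest z
    exactBlock-view arrange m c rest z∈ with ∈-concatMap-elim (placeBlock (arrange rest)) (permutations (m ∷ c)) z∈
    ... | B , B∈ , z∈₁ with ∈-concatMap-elim (insertions B) (arrange rest) z∈₁
    ... | r , r∈ , z∈₂ with ∈-insertions⁻ B r z∈₂
    ... | pre , post , refl , refl = record
      { block = B ; pre = pre ; post = post ; block∈ = B∈ ; remainder∈ = r∈ ; z≡ = refl }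

    exactBlock-intro : (arrange : Enumerator) (m : A) (G : List A) {c rest B : List A}
                       {pre post : List (List A)} → (c , rest) ∈ splits s′ G → B ∈ permutations (m ∷ c) →
                       pre ++ post ∈ arrange rest → pre ++ B ∷ post ∈ withExactBlock arrange m G
    exactBlock-intro arrange m G {c} {rest} {B} {pre} {post} p∈ B∈ r∈ =
      ∈-concatMap-intro (exactBlockFrom arrange m) p∈
        (∈-concatMap-intro (placeBlock (arrange rest)) B∈
          (∈-concatMap-intro (insertions B) r∈ (∈-insertions⁺ B pre post)))

    record InsertionView (m : A) (r z : List (List A)) : Set where
      field
        pre post : List (List A)
        u v : List A
        r≡ : r ≡ pre ++ (u ++ v) ∷ post
        z≡ : z ≡ pre ++ (u ++ m ∷ v) ∷ post

    insertion-view : (m : A) (r : List (List A)) {z : List (List A)} → z ∈ insertIntoBlocks m r → InsertionView m r z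
    insertion-view m (b ∷ bs) z∈ with ∈-++⁻ (map (_∷ bs) (insertions m b)) z∈
    ... | inj₁ z∈ˡ with ∈-map⁻ (_∷ bs) z∈ˡ
    ...   | w , w∈ , refl with ∈-insertions⁻ m b w∈
    ...     | u , v , refl , refl = record { pre = [] ; post = bs ; u = u ; v = v ; r≡ = refl ; z≡ = refl }
    insertion-view m (b ∷ bs) z∈ | inj₂ z∈ʳ with ∈-map⁻ (b ∷_) z∈ʳ
    ...   | w , w∈ , refl with insertion-view m bs w∈
    ...     | record { pre = pre ; post = post ; u = u ; v = v ; r≡ = refl ; z≡ = refl } =
                record { pre = b ∷ pre ; post = post ; u = u ; v = v ; r≡ = refl ; z≡ = refl }

    insertion-intro : (m : A) (pre : List (List A)) (u v : List A) (post : List (List A)) →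
                      pre ++ (u ++ m ∷ v) ∷ post ∈ insertIntoBlocks m (pre ++ (u ++ v) ∷ post)
    insertion-intro m [] u v post = ∈-++⁺ˡ (∈-map⁺ (_∷ post) (∈-insertions⁺ m u v))
    insertion-intro m (b ∷ pre) u v post =
      ∈-++⁺ʳ (map (_∷ (pre ++ (u ++ v) ∷ post)) (insertions m b)) (∈-map⁺ (b ∷_) (insertion-intro m pre u v post))

    Sound : ℕ → Enumerator → Set
    Sound k arrange = ∀ G {z} → z ∈ arrange G → IsArrangement k G z

    withExactBlock-sound : ∀ {k} (arrange : Enumerator) → Sound k arrange →
                           ∀ m G {z} → z ∈ withExactBlock arrange m G → IsArrangement (suc k) (m ∷ G) z
    withExactBlock-sound arrange sound m G z∈ with ∈-concatMap-elim (exactBlockFrom arrange m) (splits s′ G) z∈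
    ... | (c , rest) , p∈ , z∈p with exactBlock-view arrange m c rest z∈p
    ... | record { block = B ; pre = pre ; post = post ; block∈ = B∈ ; remainder∈ = r∈ ; z≡ = refl }
        with sound rest r∈ | splits-sound s′ G p∈
    ... | arrangement len large covers | interleaving , |c| =
      arrangement (trans (length-middle pre B post) (cong suc len))
                  (All-middle⁺ pre large (≤-reflexive (sym |B|)))
                  (begin concat (pre ++ B ∷ post)     ↭⟨ concat-middle pre B post ⟩
                         B ++ concat (pre ++ post)    ↭⟨ ++⁺ (permutations-sound (m ∷ c) B∈) covers ⟩
                         m ∷ c ++ rest                ↭⟨ ↭-prep m (↭-sym (toPermutation interleaving)) ⟩
                         m ∷ G                        ∎)
      where
      open Perm.PermutationReasoning
      |B| : length B ≡ suc s′
      |B| = trans (↭-length (permutations-sound (m ∷ c) B∈)) (cong suc |c|)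

    insertIntoBlocks-sound : ∀ {k G r z} (m : A) → IsArrangement k G r → z ∈ insertIntoBlocks m r →
                             IsArrangement k (m ∷ G) z
    insertIntoBlocks-sound {r = r} m (arrangement len large covers) z∈ with insertion-view m r z∈
    ... | record { pre = pre ; post = post ; u = u ; v = v ; r≡ = refl ; z≡ = refl } =
      arrangement (trans (length-middle pre (u ++ m ∷ v) post) (trans (sym (length-middle pre (u ++ v) post)) len))
                  (All-middle⁺ pre large-rest (≤-trans large-uv (≤-trans (n≤1+n _) (≤-reflexive (sym (length-middle u m v))))))
                  (begin concat (pre ++ (u ++ m ∷ v) ∷ post)     ↭⟨ concat-middle pre (u ++ m ∷ v) post ⟩
                         (u ++ m ∷ v) ++ concat (pre ++ post)    ↭⟨ ++⁺ʳ (concat (pre ++ post)) (shift m u v) ⟩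
                         m ∷ (u ++ v) ++ concat (pre ++ post)    ↭⟨ ↭-prep m (↭-sym (concat-middle pre (u ++ v) post)) ⟩
                         m ∷ concat (pre ++ (u ++ v) ∷ post)     ↭⟨ ↭-prep m covers ⟩
                         m ∷ _                                   ∎)
      where
      open Perm.PermutationReasoning
      large-rest = proj₁ (All-middle⁻ pre large)
      large-uv = proj₂ (All-middle⁻ pre large)

    arrangements-step-sound : ∀ {k} m G → Sound k (arrangements k) →
                              (∀ {r} → r ∈ arrangements (suc k) G → IsArrangement (suc k) G r) →
                              ∀ {z} → z ∈ arrangements (suc k) (m ∷ G) → IsArrangement (suc k) (m ∷ G) z
    arrangements-step-sound {k} m G sound-k sound-G z∈ with ∈-++⁻ (withExactBlock (arrangements k) m G) z∈
    ... | inj₁ z∈ˡ = withExactBlock-sound (arrangements k) sound-k m G z∈ˡ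
    ... | inj₂ z∈ʳ with ∈-concatMap-elim (insertIntoBlocks m) (arrangements (suc k) G) z∈ʳ
    ...   | r , r∈ , z∈r = insertIntoBlocks-sound m (sound-G r∈) z∈r

    sound : ∀ k → Sound k (arrangements k)
    sound zero [] (here refl) = arrangement refl [] ↭-refl
    sound (suc k) (m ∷ G) = arrangements-step-sound m G (sound k) (sound (suc k) G)

    -- Counting.  Each arrangement r of G into k blocks yields |G| + k
    -- insertions of m, and each arrangement into k - 1 blocks yields k
    -- placements of a new block.
    length-insertIntoBlocks : (m : A) (r : List (List A)) → length (insertIntoBlocks m r) ≡ length (concat r) + length r
    length-insertIntoBlocks m [] = refl
    length-insertIntoBlocks m (b ∷ bs) = begin
      length (map (_∷ bs) (insertions m b) ++ map (b ∷_) (insertIntoBlocks m bs))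
        ≡⟨ length-++ (map (_∷ bs) (insertions m b)) ⟩
      length (map (_∷ bs) (insertions m b)) + length (map (b ∷_) (insertIntoBlocks m bs))
        ≡⟨ cong₂ _+_ (length-map (_∷ bs) (insertions m b)) (length-map (b ∷_) (insertIntoBlocks m bs)) ⟩
      length (insertions m b) + length (insertIntoBlocks m bs)
        ≡⟨ cong₂ _+_ (length-insertions m b) (length-insertIntoBlocks m bs) ⟩
      suc (length b) + (length (concat bs) + length bs)
        ≡⟨ +-suc-assoc (length b) (length (concat bs)) (length bs) ⟩
      (length b + length (concat bs)) + suc (length bs)
        ≡⟨ cong (_+ suc (length bs)) (sym (length-++ b)) ⟩
      length (concat (b ∷ bs)) + length (b ∷ bs) ∎
      where
      open ≡-Reasoning
      +-suc-assoc : ∀ a b c → suc a + (b + c) ≡ (a + b) + suc c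
      +-suc-assoc a b c = trans (cong suc (sym (+-assoc a b c))) (sym (+-suc (a + b) c))

    Counted : ℕ → Enumerator → Set
    Counted k arrange = ∀ G → length (arrange G) ≡ count k (length G)

    length-withExactBlock : ∀ {k} (arrange : Enumerator) → Sound k arrange → Counted k arrange →
                            ∀ m G → length (withExactBlock arrange m G) ≡ (length G C s′) * suc s′ ! * count k (length G ∸ s′) * suc k
    length-withExactBlock {k} arrange sound counted m G = begin
      length (withExactBlock arrange m G)
        ≡⟨ length-concatMap (exactBlockFrom arrange m) (splits s′ G) _ per-split ⟩
      length (splits s′ G) * (suc s′ ! * (count k (length G ∸ s′) * suc k))
        ≡⟨ cong (_* (suc s′ ! * (count k (length G ∸ s′) * suc k))) (length-splits s′ G) ⟩
      (length G C s′) * (suc s′ ! * (count k (length G ∸ s′) * suc k))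
        ≡⟨ sym (*-assoc (length G C s′) (suc s′ !) _) ⟩
      (length G C s′) * suc s′ ! * (count k (length G ∸ s′) * suc k)
        ≡⟨ sym (*-assoc ((length G C s′) * suc s′ !) (count k (length G ∸ s′)) (suc k)) ⟩
      (length G C s′) * suc s′ ! * count k (length G ∸ s′) * suc k ∎
      where
      open ≡-Reasoning
      per-block : ∀ rest B → length (placeBlock (arrange rest) B) ≡ count k (length rest) * suc k
      per-block rest B = trans (length-concatMap (insertions B) (arrange rest) (suc k)
                                 λ r r∈ → trans (length-insertions B r) (cong suc (IsArrangement.blockCount (sound rest r∈))))
                               (cong (_* suc k) (counted rest))
      per-split : ∀ p → p ∈ splits s′ G → length (exactBlockFrom arrange m p) ≡ suc s′ ! * (count k (length G ∸ s′) * suc k)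
      per-split (c , rest) p∈ with splits-sound s′ G p∈
      ... | interleaving , refl =
        trans (length-concatMap (placeBlock (arrange rest)) (permutations (m ∷ c)) _
                (λ B _ → trans (per-block rest B) (cong (λ n → count k n * suc k) (length-interleavingʳ interleaving))))
              (cong (_* _) (length-permutations (m ∷ c)))

    length-withLargerBlock : ∀ {k} (m : A) (rs : List (List (List A))) {G : List A} →
                             (∀ {r} → r ∈ rs → IsArrangement k G r) →
                             length (concatMap (insertIntoBlocks m) rs) ≡ length rs * (length G + k)
    length-withLargerBlock {k} m rs {G} sound-rs =
      length-concatMap (insertIntoBlocks m) rs (length G + k) λ r r∈ →
        let open IsArrangement (sound-rs r∈) in
        trans (length-insertIntoBlocks m r) (cong₂ _+_ (↭-length covers) blockCount)

    counted : ∀ k → Counted k (arrangements k)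
    counted zero [] = refl
    counted zero (_ ∷ _) = refl
    counted (suc k) [] = refl
    counted (suc k) (m ∷ G) = begin
      length (withExactBlock (arrangements k) m G ++ concatMap (insertIntoBlocks m) (arrangements (suc k) G))
        ≡⟨ length-++ (withExactBlock (arrangements k) m G) ⟩
      length (withExactBlock (arrangements k) m G) + length (concatMap (insertIntoBlocks m) (arrangements (suc k) G))
        ≡⟨ cong₂ _+_ (length-withExactBlock (arrangements k) (sound k) (counted k) m G)
                     (length-withLargerBlock m (arrangements (suc k) G) (sound (suc k) G)) ⟩
      exact + length (arrangements (suc k) G) * (length G + suc k)
        ≡⟨ cong (λ n → exact + n * (length G + suc k)) (counted (suc k) G) ⟩
      count (suc k) (suc (length G)) ∎
      where
      open ≡-Reasoning
      exact = (length G C s′) * suc s′ ! * count k (length G ∸ s′) * suc k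

    cover-without : (m : A) (pre : List (List A)) (u v : List A) (post : List (List A)) {G : List A} →
                    concat (pre ++ (u ++ m ∷ v) ∷ post) ↭ m ∷ G → (u ++ v) ++ concat (pre ++ post) ↭ G
    cover-without m pre u v post covers = drop-∷ (begin
      m ∷ (u ++ v) ++ concat (pre ++ post)     ↭⟨ ↭-sym (++⁺ʳ (concat (pre ++ post)) (shift m u v)) ⟩
      (u ++ m ∷ v) ++ concat (pre ++ post)     ↭⟨ ↭-sym (concat-middle pre (u ++ m ∷ v) post) ⟩
      concat (pre ++ (u ++ m ∷ v) ∷ post)     ↭⟨ covers ⟩
      m ∷ _                                   ∎)
      where open Perm.PermutationReasoning

    Complete : ℕ → Enumerator → Set
    Complete k arrange = ∀ G {z} → IsArrangement k G z → z ∈ arrange G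

    complete-exact : ∀ {k} (arrange : Enumerator) → Complete k arrange →
                     ∀ m G pre u v post → IsArrangement (suc k) (m ∷ G) (pre ++ (u ++ m ∷ v) ∷ post) →
                     length (u ++ v) ≡ s′ → pre ++ (u ++ m ∷ v) ∷ post ∈ withExactBlock arrange m G
    complete-exact arrange complete m G pre u v post (arrangement len large covers) |uv|
      with ↭⇒interleaving G (cover-without m pre u v post covers)
    ... | c , rest , interleaving , c↭uv , rest↭ =
      exactBlock-intro arrange m G split∈ block∈
        (complete rest (arrangement (suc-injective (trans (sym (length-middle pre (u ++ m ∷ v) post)) len))
                                    (proj₁ (All-middle⁻ pre large)) (↭-sym rest↭)))
      where
      split∈ : (c , rest) ∈ splits s′ G
      split∈ = subst (λ t → (c , rest) ∈ splits t G) (trans (↭-length c↭uv) |uv|) (splits-complete interleaving)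
      block∈ : u ++ m ∷ v ∈ permutations (m ∷ c)
      block∈ = permutations-complete (m ∷ c) (↭-trans (shift m u v) (↭-prep m (↭-sym c↭uv)))

    complete-larger : ∀ {k} m G pre u v post → IsArrangement k (m ∷ G) (pre ++ (u ++ m ∷ v) ∷ post) →
                      s′ < length (u ++ v) → IsArrangement k G (pre ++ (u ++ v) ∷ post)
    complete-larger m G pre u v post (arrangement len large covers) s<|uv| =
      arrangement (trans (length-middle pre (u ++ v) post) (trans (sym (length-middle pre (u ++ m ∷ v) post)) len))
                  (All-middle⁺ pre (proj₁ (All-middle⁻ pre large)) s<|uv|)
                  (↭-trans (concat-middle pre (u ++ v) post) (cover-without m pre u v post covers))

    arrangements-step-complete : ∀ {k} m G → Complete k (arrangements k) →
                                 (∀ {r} → IsArrangement (suc k) G r → r ∈ arrangements (suc k) G) →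
                                 ∀ {z} → IsArrangement (suc k) (m ∷ G) z → z ∈ arrangements (suc k) (m ∷ G)
    arrangements-step-complete {k} m G complete-k complete-G {z} a@(arrangement _ large covers)
      with ∈-concat⁻′ z (∈-resp-↭ (↭-sym covers) (here refl))
    ... | B , m∈B , B∈z with ∈-∃++ B∈z
    ... | pre , post , refl with ∈-∃++ m∈B
    ... | u , v , refl with m≤n⇒m<n∨m≡n (≤-pred (subst (suc s′ ≤_) (length-middle u m v) (proj₂ (All-middle⁻ pre large))))
    ... | inj₂ |uv| = ∈-++⁺ˡ (complete-exact (arrangements k) complete-k m G pre u v post a (sym |uv|))
    ... | inj₁ s<|uv| = ∈-++⁺ʳ (withExactBlock (arrangements k) m G)
            (∈-concatMap-intro (insertIntoBlocks m) (complete-G (complete-larger m G pre u v post a s<|uv|))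
                               (insertion-intro m pre u v post))

    complete : ∀ k → Complete k (arrangements k)
    complete zero [] {[]} _ = here refl
    complete zero (x ∷ G) {[]} (arrangement _ _ covers) with () ← ↭-empty-inv (↭-sym covers)
    complete (suc k) [] {[] ∷ _} (arrangement _ (() ∷ _) _)
    complete (suc k) [] {(_ ∷ _) ∷ _} (arrangement _ _ covers) with () ← ↭-empty-inv covers
    complete (suc k) (m ∷ G) = arrangements-step-complete m G (complete k) (complete (suc k) G)

    -- When m is absent from G, m occurs in an enumerated
    -- arrangement of m ∷ G in exactly one block; that block, its position
    -- and the arrangement it was inserted into are determined by the result.
    UniqueOn : Enumerator → Set
    UniqueOn arrange = ∀ G → Unique G → Unique (arrange G)

    ∉-arrangement : ∀ {k G r} {m : A} → m ∉ G → IsArrangement k G r → m ∉ concat r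
    ∉-arrangement m∉G a m∈r = m∉G (∈-resp-↭ (IsArrangement.covers a) m∈r)

    ∉-concat-++ˡ : {m : A} (u : List (List A)) {v : List (List A)} → m ∉ concat (u ++ v) → m ∉ concat u
    ∉-concat-++ˡ u {v} m∉ m∈ = m∉ (subst (_ ∈_) (concat-++ u v) (∈-++⁺ˡ m∈))

    ∉-concat-++ʳ : {m : A} (u : List (List A)) {v : List (List A)} → m ∉ concat (u ++ v) → m ∉ concat v
    ∉-concat-++ʳ u {v} m∉ m∈ = m∉ (subst (_ ∈_) (concat-++ u v) (∈-++⁺ʳ (concat u) m∈))

    Unique-insertIntoBlocks : (m : A) (r : List (List A)) → m ∉ concat r → Unique (insertIntoBlocks m r)
    Unique-insertIntoBlocks m [] _ = []
    Unique-insertIntoBlocks m (b ∷ bs) m∉ =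
      Unique.++⁺ (Unique.map⁺ ∷-injectiveˡ (Unique-insertions m b (λ m∈b → m∉ (∈-++⁺ˡ m∈b))))
                 (Unique.map⁺ ∷-injectiveʳ (Unique-insertIntoBlocks m bs (λ m∈bs → m∉ (∈-++⁺ʳ b m∈bs))))
                 λ (z∈ˡ , z∈ʳ) → let (w , w∈ , e) = ∈-map⁻ (_∷ bs) z∈ˡ
                                     (_ , _ , e') = ∈-map⁻ (b ∷_) z∈ʳ
                                     (u , v , _ , w≡) = ∈-insertions⁻ m b w∈
                                     m∈w = subst (m ∈_) (sym w≡) (∈-++⁺ʳ u (here refl))
                                 in m∉ (∈-++⁺ˡ (subst (m ∈_) (∷-injectiveˡ (trans (sym e) e')) m∈w))

    insertion-unique : {m : A} {r r' z : List (List A)} → m ∉ concat r → m ∉ concat r' →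
                       InsertionView m r z → InsertionView m r' z → r ≡ r'
    insertion-unique {m} m∉ m∉'
      record { pre = pre ; post = post ; u = u ; v = v ; r≡ = refl ; z≡ = refl }
      record { pre = pre' ; post = post' ; u = u' ; v = v' ; r≡ = refl ; z≡ = z≡ }
      with marked-block-unique pre pre' (∉-concat-++ˡ pre m∉) (∉-concat-++ˡ pre' m∉')
                               (∈-++⁺ʳ u (here refl)) (∈-++⁺ʳ u' (here refl)) z≡
    ... | refl , block≡ , refl with first-split-unique (m ≡_) u u' (∉⇒All≢ u (m∉u pre m∉)) (∉⇒All≢ u' (m∉u pre' m∉'))
                                                        refl refl block≡
      where
      m∉u : ∀ pre {u v post} → m ∉ concat (pre ++ (u ++ v) ∷ post) → m ∉ u
      m∉u pre m∉ m∈u = ∉-concat-++ʳ pre m∉ (∈-++⁺ˡ (∈-++⁺ˡ m∈u))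
    ... | refl , _ , refl = refl

    module _ {m : A} {rs : List (List (List A))} (avoid : ∀ {r} → r ∈ rs → m ∉ concat r) where

      placeBlock-position : ∀ {B B' r r' z} → m ∈ B → m ∈ B' → r ∈ rs → r' ∈ rs →
                            z ∈ insertions B r → z ∈ insertions B' r' → B ≡ B' × r ≡ r'
      placeBlock-position m∈B m∈B' r∈ r'∈ z∈ z∈' with ∈-insertions⁻ _ _ z∈ | ∈-insertions⁻ _ _ z∈'
      ... | u , v , refl , refl | u' , v' , refl , z≡
          with marked-block-unique u u' (∉-concat-++ˡ u (avoid r∈)) (∉-concat-++ˡ u' (avoid r'∈)) m∈B m∈B' z≡
      ... | refl , B≡ , refl = B≡ , refl

      Unique-placeBlock : ∀ {B} → m ∈ B → Unique rs → Unique (placeBlock rs B)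
      Unique-placeBlock m∈B urs =
        Unique-concatMap (insertions _) rs urs
          (λ r r∈ → Unique-insertions _ r (λ B∈r → avoid r∈ (∈-concat⁺′ m∈B B∈r)))
          (λ r r' r∈ r'∈ z∈ z∈' → proj₂ (placeBlock-position m∈B m∈B r∈ r'∈ z∈ z∈'))

      placeBlock-disjoint : ∀ {B B' z} → m ∈ B → m ∈ B' → z ∈ placeBlock rs B → z ∈ placeBlock rs B' → B ≡ B'
      placeBlock-disjoint {B} {B'} m∈B m∈B' z∈ z∈'
        with ∈-concatMap-elim (insertions B) rs z∈ | ∈-concatMap-elim (insertions B') rs z∈'
      ... | r , r∈ , z∈r | r' , r'∈ , z∈r' = proj₁ (placeBlock-position m∈B m∈B' r∈ r'∈ z∈r z∈r')

    m∈block : (m : A) (c : List A) {B : List A} → B ∈ permutations (m ∷ c) → m ∈ B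
    m∈block m c B∈ = ∈-resp-↭ (↭-sym (permutations-sound (m ∷ c) B∈)) (here refl)

    avoid-remainder : ∀ {k} {arrange : Enumerator} → Sound k arrange →
                      ∀ {m G c rest r} → m ∉ G → (c , rest) ∈ splits s′ G → r ∈ arrange rest → m ∉ concat r
    avoid-remainder sound-arrange {G = G} {rest = rest} m∉G p∈ r∈ =
      ∉-arrangement (λ m∈rest → m∉G (∈-interleavingʳ (proj₁ (splits-sound s′ G p∈)) m∈rest)) (sound-arrange rest r∈)

    -- Exact blocks coming from distinct splits of G are distinct, since the
    -- block determines the chosen companions up to order, and hence the split.
    module _ {k : ℕ} (arrange : Enumerator) (sound-arrange : Sound k arrange)
             {m : A} {G : List A} (m∉G : m ∉ G) (uG : Unique G) where

      Unique-exactBlockFrom : UniqueOn arrange → ∀ p → p ∈ splits s′ G → Unique (exactBlockFrom arrange m p)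
      Unique-exactBlockFrom unique-arrange (c , rest) p∈ =
        Unique-concatMap (placeBlock (arrange rest)) (permutations (m ∷ c))
          (Unique-permutations (m ∷ c) (∉⇒All≢ c (λ m∈c → m∉G (∈-interleavingˡ i m∈c)) ∷ Unique-interleavingˡ uG i))
          (λ B B∈ → Unique-placeBlock (avoid-remainder sound-arrange m∉G p∈) (m∈block m c B∈) (unique-arrange rest (Unique-interleavingʳ uG i)))
          (λ B B' B∈ B'∈ → placeBlock-disjoint (avoid-remainder sound-arrange m∉G p∈) (m∈block m c B∈) (m∈block m c B'∈))
        where
        i = proj₁ (splits-sound s′ G p∈)

      exactBlockFrom-disjoint : ∀ p p' {z} → p ∈ splits s′ G → p' ∈ splits s′ G →
                                z ∈ exactBlockFrom arrange m p → z ∈ exactBlockFrom arrange m p' → p ≡ p'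
      exactBlockFrom-disjoint (c , rest) (c' , rest') p∈ p'∈ z∈ z∈'
        with exactBlock-view arrange m c rest z∈ | exactBlock-view arrange m c' rest' z∈'
      ... | record { block = B ; pre = pre ; block∈ = B∈ ; remainder∈ = r∈ ; z≡ = refl }
          | record { block = B' ; pre = pre' ; block∈ = B'∈ ; remainder∈ = r'∈ ; z≡ = z≡ }
          with marked-block-unique pre pre' (∉-concat-++ˡ pre (avoid-remainder sound-arrange m∉G p∈ r∈))
                                   (∉-concat-++ˡ pre' (avoid-remainder sound-arrange m∉G p'∈ r'∈)) (m∈block m c B∈) (m∈block m c' B'∈) z≡
      ... | _ , refl , _ with interleaving-determined uG (proj₁ (splits-sound s′ G p∈)) (proj₁ (splits-sound s′ G p'∈))
                                (drop-∷ (↭-trans (↭-sym (permutations-sound (m ∷ c) B∈)) (permutations-sound (m ∷ c') B'∈)))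
      ... | refl , refl = refl

      Unique-withExactBlock : UniqueOn arrange → Unique (withExactBlock arrange m G)
      Unique-withExactBlock unique-arrange =
        Unique-concatMap (exactBlockFrom arrange m) (splits s′ G) (Unique-splits s′ G uG)
          (Unique-exactBlockFrom unique-arrange) exactBlockFrom-disjoint

    -- The two families are disjoint: in the first, m's block has exactly s
    -- elements, in the second more.
    exact-larger-disjoint : ∀ {k} m G → m ∉ G → ∀ {z} → z ∈ withExactBlock (arrangements k) m G →
                            z ∈ concatMap (insertIntoBlocks m) (arrangements (suc k) G) → ⊥
    exact-larger-disjoint {k} m G m∉G z∈ˡ z∈ʳ
      with ∈-concatMap-elim (exactBlockFrom (arrangements k) m) (splits s′ G) z∈ˡ
         | ∈-concatMap-elim (insertIntoBlocks m) (arrangements (suc k) G) z∈ʳ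
    ... | (c , rest) , p∈ , z∈p | r , r∈ , z∈r
      with exactBlock-view (arrangements k) m c rest z∈p | insertion-view m r z∈r | sound (suc k) G r∈
    ... | record { block = B ; pre = pre ; block∈ = B∈ ; remainder∈ = r'∈ ; z≡ = refl }
        | record { pre = pre' ; u = u ; v = v ; r≡ = refl ; z≡ = z≡ }
        | a@(arrangement _ large _)
      with marked-block-unique pre pre' (∉-concat-++ˡ pre (avoid-remainder (sound k) m∉G p∈ r'∈))
                               (∉-concat-++ˡ pre' (∉-arrangement m∉G a)) (m∈block m c B∈) (∈-++⁺ʳ u (here refl)) z≡
    ... | _ , refl , _ = <-irrefl (suc-injective (trans (sym |B|) (length-middle u m v))) (proj₂ (All-middle⁻ pre' large))
      where
      |B| : length (u ++ m ∷ v) ≡ suc s′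
      |B| = trans (↭-length (permutations-sound (m ∷ c) B∈)) (cong suc (proj₂ (splits-sound s′ G p∈)))

    arrangements-step-unique : ∀ {k} m G → UniqueOn (arrangements k) → Unique (m ∷ G) →
                               Unique (arrangements (suc k) G) → Unique (arrangements (suc k) (m ∷ G))
    arrangements-step-unique {k} m G unique-k (m≢G ∷ uG) unique-G =
      Unique.++⁺ (Unique-withExactBlock (arrangements k) (sound k) m∉G uG unique-k)
                 (Unique-concatMap (insertIntoBlocks m) (arrangements (suc k) G) unique-G
                   (λ r r∈ → Unique-insertIntoBlocks m r (avoid r∈))
                   (λ r r' r∈ r'∈ z∈ z∈' → insertion-unique (avoid r∈) (avoid r'∈) (insertion-view m r z∈) (insertion-view m r' z∈')))
                 (λ (z∈ˡ , z∈ʳ) → exact-larger-disjoint m G m∉G z∈ˡ z∈ʳ)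
      where
      m∉G = All≢⇒∉ m≢G
      avoid : ∀ {r} → r ∈ arrangements (suc k) G → m ∉ concat r
      avoid r∈ = ∉-arrangement m∉G (sound (suc k) G r∈)

    unique : ∀ k → UniqueOn (arrangements k)
    unique zero [] _ = [] ∷ []
    unique zero (_ ∷ _) _ = []
    unique (suc k) [] _ = []
    unique (suc k) (m ∷ G) u@(_ ∷ uG) = arrangements-step-unique m G (unique k) u (unique (suc k) G uG)

NonEmpty : List A → Set
NonEmpty b = 1 ≤ length b

firsts-∈ : {y : A} {c : List A} (xs : List (List A)) → (y ∷ c) ∈ xs → y ∈ firsts xs
firsts-∈ ([] ∷ xs) (there p) = firsts-∈ xs p
firsts-∈ ((x ∷ b) ∷ xs) (here refl) = here refl
firsts-∈ ((x ∷ b) ∷ xs) (there p) = there (firsts-∈ xs p)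

firsts-⊆-concat : {y : A} (xs : List (List A)) → y ∈ firsts xs → y ∈ concat xs
firsts-⊆-concat ([] ∷ xs) p = firsts-⊆-concat xs p
firsts-⊆-concat ((x ∷ b) ∷ xs) (here refl) = here refl
firsts-⊆-concat ((x ∷ b) ∷ xs) (there p) = ∈-++⁺ʳ (x ∷ b) (firsts-⊆-concat xs p)

-- Two rearrangements of each other, both with strictly increasing first
-- elements (for an asymmetric order), are equal: their first blocks agree,
-- as neither first element can exceed the other.
sorted-↭-unique : {_<_ : A → A → Set} → (∀ {a b} → a < b → b < a → ⊥) → (x y : List (List A)) → x ↭ y →
                  All NonEmpty x → All NonEmpty y → AllPairs _<_ (firsts x) → AllPairs _<_ (firsts y) → x ≡ y
sorted-↭-unique asym [] y p _ _ _ _ = sym (↭-empty-inv (↭-sym p))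
sorted-↭-unique asym (b ∷ x) [] p _ _ _ _ with () ← ↭-empty-inv p
sorted-↭-unique asym ((h ∷ b) ∷ x) ((h' ∷ b') ∷ y) p (_ ∷ nx) (_ ∷ ny) (hx ∷ sx) (hy ∷ sy)
  with ∈-resp-↭ p (here refl) | ∈-resp-↭ (↭-sym p) (here refl)
... | here refl | _ = cong ((h ∷ b) ∷_) (sorted-↭-unique asym x y (drop-∷ p) nx ny sx sy)
... | there _ | here refl = cong ((h ∷ b) ∷_) (sorted-↭-unique asym x y (drop-∷ p) nx ny sx sy)
... | there p₁ | there p₂ = ⊥-elim (asym (All.lookup hy (firsts-∈ y p₁)) (All.lookup hx (firsts-∈ x p₂)))

Unique-++ʳ : (xs : List A) {ys : List A} → Unique (xs ++ ys) → Unique ys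
Unique-++ʳ [] u = u
Unique-++ʳ (x ∷ xs) (_ ∷ u) = Unique-++ʳ xs u

Unique-firsts : (xs : List (List A)) → All NonEmpty xs → Unique (concat xs) → Unique (firsts xs)
Unique-firsts [] _ _ = []
Unique-firsts ((x ∷ b) ∷ xs) (_ ∷ ne) (x∉ ∷ u) =
  All.tabulate (λ y∈ → All.lookup x∉ (∈-++⁺ʳ b (firsts-⊆-concat xs y∈))) ∷ Unique-firsts xs ne (Unique-++ʳ b u)

Unique-blocks : (xs : List (List A)) → All NonEmpty xs → Unique (concat xs) → Unique xs
Unique-blocks [] _ _ = []
Unique-blocks ((y ∷ b) ∷ bs) ne@(_ ∷ ne′) u with Unique-firsts ((y ∷ b) ∷ bs) ne u
... | y∉ ∷ _ = All.tabulate (λ c∈ e → All≢⇒∉ y∉ (firsts-∈ bs (subst (_∈ bs) (sym e) c∈)))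
               ∷ Unique-blocks bs ne′ (Unique-++ʳ (y ∷ b) u)

module FinBlocks (n : ℕ) where

  Unique-full : (l : List (Fin n)) → Unique l → length l ≡ n → l ↭ allFin n
  Unique-full l ul |l| = Unique-⇔-↭ ul (Unique.allFin⁺ n) (λ _ → ∈-allFin _) (λ {y} _ → contains y)
    where
    open import Data.List.Membership.DecPropositional (Fin._≟_ {n}) using (_∈?_)
    contains : ∀ y → y ∈ l
    contains y with y ∈? l
    ... | yes y∈l = y∈l
    ... | no y∉l = ⊥-elim (<-irrefl |l| (≤-trans too-long (≤-reflexive (length-tabulate {n = n} (λ i → i)))))
      where
      too-long : suc (length l) ≤ length (allFin n)
      too-long = Unique-⊆-length {xs = y ∷ l} (∉⇒All≢ l y∉l ∷ ul) (λ _ → ∈-allFin _)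

  first : List (Fin n) → ℕ
  first [] = 0
  first (x ∷ _) = toℕ x

  byFirst : DecTotalOrder _ _ _
  byFirst = On.decTotalOrder ≤-decTotalOrder first

  open import Data.List.Sort byFirst public using (sort; sort-↭; sort-↗)

  increasing-firsts : (xs : List (List (Fin n))) → All NonEmpty xs →
                      AllPairs (λ b c → first b ≤ first c) xs → Unique (firsts xs) → AllPairs _<ᶠ_ (firsts xs)
  increasing-firsts [] _ _ _ = []
  increasing-firsts ((x ∷ b) ∷ xs) (_ ∷ ne) (x≤ ∷ sorted) (x∉ ∷ u) = above xs ne x≤ x∉ ∷ increasing-firsts xs ne sorted u
    where
    above : ∀ ys → All NonEmpty ys → All (λ c → toℕ x ≤ first c) ys → All (x ≢_) (firsts ys) → All (x <ᶠ_) (firsts ys)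
    above [] _ _ _ = []
    above ((y ∷ c) ∷ ys) (_ ∷ ne) (x≤y ∷ x≤) (x≢y ∷ x≢) = ≤∧≢⇒< x≤y (λ e → x≢y (Fin.toℕ-injective e)) ∷ above ys ne x≤ x≢

  sort-increasing : (z : List (List (Fin n))) → All NonEmpty z → Unique (concat z) → AllPairs _<ᶠ_ (firsts (sort z))
  sort-increasing z ne u = increasing-firsts (sort z) ne′ (Sorted⇒AllPairs (DecTotalOrder.totalOrder byFirst) (sort-↗ z))
                        (Unique-firsts (sort z) ne′ (Unique-resp-↭ (concat-↭ (↭-sym (sort-↭ z))) u))
    where
    ne′ = All-resp-↭ (↭-sym (sort-↭ z)) ne

∈-words : (xs w : List A) → All (_∈ xs) w → w ∈ words xs (length w)
∈-words xs [] [] = here refl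
∈-words xs (y ∷ w) (y∈ ∷ w⊆) = ∈-concatMap-intro (λ x → map (x ∷_) (words xs (length w))) y∈ (∈-map⁺ (y ∷_) (∈-words xs w w⊆))

Unique-words : (xs : List A) (m : ℕ) → Unique xs → Unique (words xs m)
Unique-words xs zero _ = [] ∷ []
Unique-words xs (suc m) uxs = Unique-concatMap (λ x → map (x ∷_) (words xs m)) xs uxs
  (λ x _ → Unique.map⁺ ∷-injectiveʳ (Unique-words xs m uxs))
  (λ x y _ _ w∈x w∈y → let (_ , _ , ex) = ∈-map⁻ (x ∷_) w∈x
                           (_ , _ , ey) = ∈-map⁻ (y ∷_) w∈y
                       in ∷-injectiveˡ (trans (sym ex) ey))

∈-cuts : (xss : List (List A)) → All NonEmpty xss → xss ∈ cuts (concat xss)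
∈-cuts [] [] = here refl
∈-cuts ([] ∷ _) (() ∷ _)
∈-cuts ((x ∷ []) ∷ [] ∷ _) (_ ∷ () ∷ _)
∈-cuts ((x ∷ []) ∷ []) _ = here refl
∈-cuts ((x ∷ []) ∷ bs@((_ ∷ _) ∷ _)) (_ ∷ ne) = ∈-concatMap-intro (prepend x) (∈-cuts bs ne) (here refl)
∈-cuts ((x ∷ b@(_ ∷ _)) ∷ bs) (_ ∷ ne) = ∈-concatMap-intro (prepend x) (∈-cuts (b ∷ bs) (s≤s z≤n ∷ ne)) (there (here refl))

cuts-concat : (l : List A) {z : List (List A)} → z ∈ cuts l → concat z ≡ l
cuts-concat [] (here refl) = refl
cuts-concat (x ∷ l) z∈ with ∈-concatMap-elim (prepend x) (cuts l) z∈
... | [] , bs∈ , here refl = cong (x ∷_) (cuts-concat l bs∈)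
... | b ∷ bs , bs∈ , here refl = cong (x ∷_) (cuts-concat l bs∈)
... | b ∷ bs , bs∈ , there (here refl) = cong (x ∷_) (cuts-concat l bs∈)

cuts-nonempty : (l : List A) {z : List (List A)} → z ∈ cuts l → All NonEmpty z
cuts-nonempty [] (here refl) = []
cuts-nonempty (x ∷ l) z∈ with ∈-concatMap-elim (prepend x) (cuts l) z∈
... | [] , bs∈ , here refl = s≤s z≤n ∷ []
... | b ∷ bs , bs∈ , here refl = s≤s z≤n ∷ cuts-nonempty l bs∈
... | b ∷ bs , bs∈ , there (here refl) = s≤s z≤n ∷ All.tail (cuts-nonempty l bs∈)

dropFirst : List (List A) → List (List A)
dropFirst [] = []
dropFirst ([] ∷ bs) = bs
dropFirst ((_ ∷ []) ∷ bs) = bs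
dropFirst ((_ ∷ y ∷ b) ∷ bs) = (y ∷ b) ∷ bs

dropFirst-prepend : (x : A) (bs : List (List A)) → All NonEmpty bs → ∀ {z} → z ∈ prepend x bs → dropFirst z ≡ bs
dropFirst-prepend x [] _ (here refl) = refl
dropFirst-prepend x (b ∷ bs) _ (here refl) = refl
dropFirst-prepend x ((y ∷ b) ∷ bs) _ (there (here refl)) = refl
dropFirst-prepend x ([] ∷ bs) (() ∷ _) (there (here refl))

Unique-cuts : (l : List A) → Unique (cuts l)
Unique-cuts [] = [] ∷ []
Unique-cuts (x ∷ l) = Unique-concatMap (prepend x) (cuts l) (Unique-cuts l) Unique-prepend
  (λ bs bs' bs∈ bs'∈ z∈ z∈' → trans (sym (dropFirst-prepend x bs (cuts-nonempty l bs∈) z∈))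
                                    (dropFirst-prepend x bs' (cuts-nonempty l bs'∈) z∈'))
  where
  Unique-prepend : ∀ bs → bs ∈ cuts l → Unique (prepend x bs)
  Unique-prepend [] _ = [] ∷ []
  Unique-prepend ([] ∷ bs) bs∈ with cuts-nonempty l bs∈
  ... | () ∷ _
  Unique-prepend ((y ∷ b) ∷ bs) _ = ((λ e → []≢∷ (∷-injectiveʳ (∷-injectiveˡ e))) ∷ []) ∷ [] ∷ []
    where
    []≢∷ : {y : A} {b : List A} → [] ≢ y ∷ b
    []≢∷ ()

Unique-candidates : (n : ℕ) → Unique (candidates n)
Unique-candidates n = Unique-concatMap cuts (words (allFin n) n) (Unique-words (allFin n) n (Unique.allFin⁺ n))
  (λ w _ → Unique-cuts w) (λ w w' _ _ z∈ z∈' → trans (sym (cuts-concat w z∈)) (cuts-concat w' z∈'))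

∈-candidates : {n : ℕ} (xss : List (List (Fin n))) → All NonEmpty xss → length (concat xss) ≡ n → xss ∈ candidates n
∈-candidates {n} xss ne |xss| = ∈-concatMap-intro cuts word∈ (∈-cuts xss ne)
  where
  word∈ : concat xss ∈ words (allFin n) n
  word∈ = subst (λ m → concat xss ∈ words (allFin n) m) |xss| (∈-words (allFin n) (concat xss) (All.tabulate (λ _ → ∈-allFin _)))

-- The Lah partitions counted by
-- L (suc s′) n k are the arrangements of {0,…,n-1} into k blocks whose blocks
-- are listed by increasing first elements.  Listing the k blocks of each in
-- all k! orders gives every arrangement exactly once, so
-- L (suc s′) n k * k! is the number of arrangements.
module LahArrangements (s′ n k : ℕ) where
  open Arrangements s′
  open FinBlocks n

  lahPartitions : List (List (List (Fin n)))
  lahPartitions = filter (isOLP? (suc s′) n k) (candidates n)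

  orderedLahPartitions : List (List (List (Fin n)))
  orderedLahPartitions = concatMap permutations lahPartitions

  isLah : ∀ {x} → x ∈ lahPartitions → IsOLP (suc s′) n k x
  isLah x∈ = proj₂ (∈-filter⁻ (isOLP? (suc s′) n k) {xs = candidates n} x∈)

  nonEmpty : ∀ {x} → IsOLP (suc s′) n k x → All NonEmpty x
  nonEmpty (_ , sizes , _) = All.map proj₁ sizes

  lah-arrangement : ∀ {x z} → x ∈ lahPartitions → z ∈ permutations x → IsArrangement k (allFin n) z
  lah-arrangement {x} x∈ z∈ with isLah x∈ | permutations-sound x z∈
  ... | |x| , sizes , unique , |concat| , _ | z↭x =
    arrangement (trans (↭-length z↭x) |x|) (All-resp-↭ (↭-sym z↭x) (All.map proj₂ sizes))
                (↭-trans (concat-↭ z↭x) (Unique-full (concat x) unique |concat|))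

  arrangement-lah : ∀ {z} → IsArrangement k (allFin n) z → z ∈ orderedLahPartitions
  arrangement-lah {z} (arrangement |z| large covers) =
    ∈-concatMap-intro permutations (∈-filter⁺ (isOLP? (suc s′) n k) sorted∈ isOLP) (permutations-complete (sort z) (↭-sym (sort-↭ z)))
    where
    nonEmpty-z = All.map (≤-trans (s≤s z≤n)) large
    unique-z = Unique-resp-↭ (↭-sym covers) (Unique.allFin⁺ n)
    covers-sorted = ↭-trans (concat-↭ (sort-↭ z)) covers
    sizes = All-resp-↭ (↭-sym (sort-↭ z)) (All.map (λ b-large → ≤-trans (s≤s z≤n) b-large , b-large) large)
    |concat| = trans (↭-length covers-sorted) (length-tabulate {n = n} (λ i → i))
    isOLP : IsOLP (suc s′) n k (sort z)
    isOLP = trans (↭-length (sort-↭ z)) |z| , sizes , Unique-resp-↭ (↭-sym covers-sorted) (Unique.allFin⁺ n) ,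
            |concat| , sort-increasing z nonEmpty-z unique-z
    sorted∈ = ∈-candidates (sort z) (All.map proj₁ sizes) |concat|

  Unique-orderedLahPartitions : Unique orderedLahPartitions
  Unique-orderedLahPartitions =
    Unique-concatMap permutations lahPartitions (Unique.filter⁺ (isOLP? (suc s′) n k) {xs = candidates n} (Unique-candidates n))
      (λ x x∈ → let (_ , _ , unique , _) = isLah x∈ in Unique-permutations x (Unique-blocks x (nonEmpty (isLah x∈)) unique))
      (λ x y x∈ y∈ z∈x z∈y → sorted-↭-unique Fin.<-asym x y (↭-trans (↭-sym (permutations-sound x z∈x)) (permutations-sound y z∈y))
                               (nonEmpty (isLah x∈)) (nonEmpty (isLah y∈)) (sorted (isLah x∈)) (sorted (isLah y∈)))
    where
    sorted : ∀ {x} → IsOLP (suc s′) n k x → AllPairs _<ᶠ_ (firsts x)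
    sorted (_ , _ , _ , _ , s) = s

  L-times-k! : L (suc s′) n k * k ! ≡ count k n
  L-times-k! = begin
    length lahPartitions * k !
      ≡⟨ length-concatMap permutations lahPartitions (k !) (λ x x∈ → trans (length-permutations x) (cong _! (proj₁ (isLah x∈)))) ⟨
    length orderedLahPartitions
      ≡⟨ ↭-length (Unique-⇔-↭ Unique-orderedLahPartitions (unique k (allFin n) (Unique.allFin⁺ n))
           (λ z∈ → let (x , x∈ , z∈x) = ∈-concatMap-elim permutations lahPartitions z∈ in complete k _ (lah-arrangement x∈ z∈x))
           (λ z∈ → arrangement-lah (sound k _ z∈))) ⟩
    length (arrangements k (allFin n))
      ≡⟨ counted k (allFin n) ⟩
    count k (length (allFin n))
      ≡⟨ cong (count k) (length-tabulate {n = n} (λ i → i)) ⟩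
    count k n ∎
    where open ≡-Reasoning

-- The recurrence of Arrangements.count, divided by k!.
mainTheorem1 : (s : ℕ) → 1 ≤ s → (k n : ℕ) → 1 ≤ k → s * k ≤ n →
    L s n k ≡ ((n ∸ 1) C (s ∸ 1)) * (s !) * L s (n ∸ s) (k ∸ 1) + (n + k ∸ 1) * L s (n ∸ 1) k
mainTheorem1 (suc s′) _ (suc k) (suc n) _ _ = *-cancelʳ-≡ _ _ (suc k !) {{suc k !≢0}} (begin
  L s (suc n) (suc k) * suc k !
    ≡⟨ L-times-k! s′ (suc n) (suc k) ⟩
  count (suc k) (suc n)
    ≡⟨ cong₂ (λ a b → (n C s′) * s ! * a * suc k + b * (n + suc k)) (L-times-k! s′ (n ∸ s′) k) (L-times-k! s′ n (suc k)) ⟨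
  (n C s′) * s ! * (L s (n ∸ s′) k * k !) * suc k + L s n (suc k) * suc k ! * (n + suc k)
    ≡⟨ regroup ((n C s′) * s !) (L s (n ∸ s′) k) (L s n (suc k)) (n + suc k) (k !) k ⟩
  ((n C s′) * s ! * L s (n ∸ s′) k + (n + suc k) * L s n (suc k)) * suc k ! ∎)
  where
  open ≡-Reasoning
  open LahArrangements using (L-times-k!)
  open Arrangements s′ using (count)
  s = suc s′
  regroup : ∀ a x y e f k → a * (x * f) * suc k + y * (suc k * f) * e ≡ (a * x + e * y) * (suc k * f)
  regroup = solve-∀
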